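{- Let $\mathcal{M}=\mathbb{Q}^{<\omega}$ and let $T=\{(x,y,z)\in\mathcal{M}^3: z\in\{x+y,\,x-y,\,-x+y,\,-x-y\}\}$. Then the group of permutations $\sigma$ of $\mathcal{M}$ preserving $T$ (i.e. $(x,y,z)\in T\Leftrightarrow(\sigma x,\sigma y,\sigma z)\in T$) is exactly $GL^\pm(\mathcal{M})$.
   Context: $\mathcal{M}=\mathbb{Q}^{<\omega}$ is the $\mathbb{Q}$-vector space of finitely supported rational sequences. $GL(\mathcal{M})$ is the group of invertible linear maps of $\mathcal{M}$. $S^\pm(\mathcal{M})$ is the group of permutations $\sigma$ of $\mathcal{M}$ with $\sigma(x)\in\{x,-x\}$ for all $x\in\mathcal{M}$. $GL^\pm(\mathcal{M})$ is the subgroup of the symmetric group of $\mathcal{M}$ generated by $GL(\mathcal{M})$ and $S^\pm(\mathcal{M})$. -}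

module Defs where

open import Data.Nat using (ℕ; zero; suc)
open import Data.Rational using (ℚ; 0ℚ; _+_; _*_; -_)
open import Data.List using (List; []; _∷_; map)
open import Data.Product using (Σ; _×_; _,_; ∃)
open import Data.Sum using (_⊎_)
open import Data.Bool using (Bool; true; false)
open import Relation.Binary.PropositionalEquality using (_≡_)

-- M = Q^{<ω}: a finitely supported rational sequence is represented by a
-- finite list of its initial coordinates (all later coordinates are 0).
M : Set
M = List ℚ

coord : M → ℕ → ℚ
coord []       _       = 0ℚ
coord (q ∷ x)  zero    = q
coord (q ∷ x)  (suc n) = coord x n

_≈_ : M → M → Set
x ≈ y = ∀ n → coord x n ≡ coord y n
infix 4 _≈_

_⊕_ : M → M → M
[]      ⊕ y       = y
(p ∷ x) ⊕ []      = p ∷ x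
(p ∷ x) ⊕ (q ∷ y) = (p + q) ∷ (x ⊕ y)
infixl 6 _⊕_

⊖_ : M → M
⊖ x = map -_ x

_·_ : ℚ → M → M
c · x = map (c *_) x

record Perm : Set where
  field
    to      : M → M
    from    : M → M
    to-cong   : ∀ {x y} → x ≈ y → to x ≈ to y
    from-cong : ∀ {x y} → x ≈ y → from x ≈ from y
    to-from : ∀ x → to (from x) ≈ x
    from-to : ∀ x → from (to x) ≈ x
open Perm public

IsGL : Perm → Set
IsGL σ = (∀ x y → to σ (x ⊕ y) ≈ to σ x ⊕ to σ y)
       × (∀ c x → to σ (c · x) ≈ c · to σ x)

IsS± : Perm → Set
IsS± σ = ∀ x → (to σ x ≈ x) ⊎ (to σ x ≈ ⊖ x)

Generator : Set
Generator = Σ Perm (λ g → IsGL g ⊎ IsS± g)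

-- a word in the generators: (g , true) stands for g, (g , false) for g⁻¹
Word : Set
Word = List (Generator × Bool)

evalWord : Word → M → M
evalWord []                        x = x
evalWord (((g , _) , true)  ∷ w)   x = to g (evalWord w x)
evalWord (((g , _) , false) ∷ w)   x = from g (evalWord w x)

-- GL^±(M): the subgroup of Sym(M) generated by GL(M) ∪ S^±(M),
-- i.e. permutations equal (pointwise) to a finite product of generators
-- and their inverses.
InGL± : Perm → Set
InGL± σ = ∃ λ (w : Word) → ∀ x → to σ x ≈ evalWord w x

T : M → M → M → Set
T x y z = (z ≈ x ⊕ y) ⊎ (z ≈ x ⊕ (⊖ y)) ⊎ (z ≈ (⊖ x) ⊕ y) ⊎ (z ≈ (⊖ x) ⊕ (⊖ y))

PreservesT : Perm → Set
PreservesT σ = ∀ x y z → (T x y z → T (to σ x) (to σ y) (to σ z))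
                       × (T (to σ x) (to σ y) (to σ z) → T x y z)

-- A permutation φ preserving T fixes 0, satisfies φ z = ± φ x exactly when z = ± x, and
-- commutes with rational scalars up to sign. If A = ± φ u, B = ± φ v, C = ± φ w are such
-- that φ (u + v) = ± (A + B) and φ (u + w) = ± (A + C), then also φ (v + w) = ± (B + C):
-- otherwise φ (u + v + w) would be T-related to three incompatible splittings. Choosing
-- E n = ± φ (eₙ) with φ (e₀ + eₙ) = ± (E 0 + E n) and letting Λ be the linear map with
-- Λ eₙ = E n, induction on the support gives φ x = ± Λ x. So Λ is bijective and
-- φ = Λ ∘ (Λ⁻¹ ∘ φ) with Λ⁻¹ ∘ φ ∈ S^±(M). Conversely, linear bijections and sign
-- changes visibly preserve T.

module Submission where

import Algebra.Properties.Monoid.Mult as MonoidMult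
open import Data.Bool using (true; false)
open import Data.Empty using (⊥-elim)
open import Data.Integer as ℤ using (ℤ; +_; -[1+_])
import Data.Integer.Solver as ℤSolver
open import Data.List using (List; []; _∷_; length; take)
import Data.List.Properties as Listₚ
open import Data.Nat as ℕ using (ℕ; zero; suc; z≤n; s≤s)
import Data.Nat.Properties as ℕₚ
open import Data.Product using (_×_; _,_; proj₁; proj₂)
open import Data.Rational as ℚ using (ℚ; 0ℚ; 1ℚ; _+_; _*_; -_; _-_; toℚᵘ; 1/_; ½; -½)
import Data.Rational.Properties as ℚₚ
import Data.Rational.Solver as ℚSolver
import Data.Rational.Unnormalised as ℚᵘ
import Data.Rational.Unnormalised.Properties as ℚᵘₚ
open import Data.Sum as Sum using (_⊎_; inj₁; inj₂)
open import Function using (_∘_; id)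
open import Level using (0ℓ)
open import Relation.Binary.Bundles using (Setoid)
import Relation.Binary.Reasoning.Setoid as SetoidReasoning
open import Relation.Binary.PropositionalEquality
open import Relation.Nullary using (Dec; yes; no; ¬_)
import Relation.Nullary.Decidable as Dec
open import Relation.Nullary.Decidable using (True; toWitness; _⊎-dec_)

open import Defs

open MonoidMult ℚₚ.+-0-monoid using (×-homo-+) renaming (_×_ to _×ℚ_)

module ℤS = ℤSolver.+-*-Solver
module ℚS = ℚSolver.+-*-Solver

fromℕ : ℕ → ℚ
fromℕ k = k ×ℚ 1ℚ

fromℤ : ℤ → ℚ
fromℤ (+ m)    = fromℕ m
fromℤ -[1+ m ] = - fromℕ (suc m)

fromℕ-+ : ∀ m n → fromℕ (m ℕ.+ n) ≡ fromℕ m + fromℕ n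
fromℕ-+ m n = ×-homo-+ 1ℚ m n

toℚᵘ-fromℕ : ∀ k → toℚᵘ (fromℕ k) ℚᵘ.≃ ℚᵘ.mkℚᵘ (+ k) 0
toℚᵘ-fromℕ zero    = ℚᵘ.*≡* refl
toℚᵘ-fromℕ (suc k) = ℚᵘₚ.≃-trans (ℚₚ.toℚᵘ-homo-+ 1ℚ (fromℕ k))
  (ℚᵘₚ.≃-trans (ℚᵘₚ.+-congʳ (toℚᵘ 1ℚ) (toℚᵘ-fromℕ k)) (ℚᵘ.*≡* (1+k k)))
  where
  1+k : ∀ k → (+ 1 ℤ.* + 1 ℤ.+ + k ℤ.* + 1) ℤ.* + 1 ≡ + suc k ℤ.* + (1 ℕ.* 1)
  1+k k = ℤS.solve 1 (λ k → let open ℤS in (con (+ 1) :* con (+ 1) :+ k :* con (+ 1)) :* con (+ 1) := (con (+ 1) :+ k) :* con (+ 1)) refl (+ k)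

toℚᵘ-fromℤ : ∀ z → toℚᵘ (fromℤ z) ℚᵘ.≃ ℚᵘ.mkℚᵘ z 0
toℚᵘ-fromℤ (+ m)    = toℚᵘ-fromℕ m
toℚᵘ-fromℤ -[1+ m ] = ℚᵘₚ.≃-trans (ℚₚ.toℚᵘ-homo‿- (fromℕ (suc m))) (ℚᵘₚ.-‿cong (toℚᵘ-fromℕ (suc m)))

fromℕ-suc-≢0 : ∀ k → fromℕ (suc k) ≢ 0ℚ
fromℕ-suc-≢0 k eq with ℚᵘₚ.≃-trans (ℚᵘₚ.≃-sym (toℚᵘ-fromℕ (suc k))) (ℚᵘₚ.≃-reflexive (cong toℚᵘ eq))
... | ℚᵘ.*≡* ()

↧*p≡↥ : ∀ p → fromℕ (ℚ.↧ₙ p) * p ≡ fromℤ (ℚ.↥ p)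
↧*p≡↥ p@(ℚ.mkℚ n d-1 _) = ℚₚ.toℚᵘ-injective
  (ℚᵘₚ.≃-trans (ℚₚ.toℚᵘ-homo-* (fromℕ (suc d-1)) p)
  (ℚᵘₚ.≃-trans (ℚᵘₚ.*-congʳ (toℚᵘ-fromℕ (suc d-1)))
  (ℚᵘₚ.≃-trans (ℚᵘ.*≡* (cross n (suc d-1))) (ℚᵘₚ.≃-sym (toℚᵘ-fromℤ n)))))
  where
  cross : ∀ n d → (+ d ℤ.* n) ℤ.* + 1 ≡ n ℤ.* + (1 ℕ.* d)
  cross n d rewrite ℕₚ.*-identityˡ d = ℤS.solve 2 (λ d n → let open ℤS in (d :* n) :* con (+ 1) := n :* d) refl (+ d) n

fromℕ-suc-nonZero : ∀ k → ℚ.NonZero (fromℕ (suc k))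
fromℕ-suc-nonZero k = ℚ.≢-nonZero (fromℕ-suc-≢0 k)

≡-↥*1/↧ : ∀ p → p ≡ fromℤ (ℚ.↥ p) * 1/_ (fromℕ (ℚ.↧ₙ p)) {{fromℕ-suc-nonZero (ℚ.denominator-1 p)}}
≡-↥*1/↧ p = begin
  p                     ≡⟨ sym (ℚₚ.*-identityˡ p) ⟩
  1ℚ * p                ≡⟨ cong (_* p) (sym (ℚₚ.*-inverseˡ D)) ⟩
  1/ D * D * p          ≡⟨ ℚₚ.*-assoc (1/ D) D p ⟩
  1/ D * (D * p)        ≡⟨ cong (1/ D *_) (↧*p≡↥ p) ⟩
  1/ D * fromℤ (ℚ.↥ p)  ≡⟨ ℚₚ.*-comm (1/ D) (fromℤ (ℚ.↥ p)) ⟩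
  fromℤ (ℚ.↥ p) * 1/ D  ∎
  where
  open ≡-Reasoning
  D = fromℕ (ℚ.↧ₙ p)
  instance _ = fromℕ-suc-nonZero (ℚ.denominator-1 p)

x*y≡0⇒y≡0 : ∀ x y → x ≢ 0ℚ → x * y ≡ 0ℚ → y ≡ 0ℚ
x*y≡0⇒y≡0 x y x≢0 xy≡0 with y ℚ.≟ 0ℚ
... | yes y≡0 = y≡0
... | no y≢0 = ⊥-elim (x≢0 (begin
  x                ≡⟨ sym (ℚₚ.*-identityʳ x) ⟩
  x * 1ℚ           ≡⟨ cong (x *_) (sym (ℚₚ.*-inverseʳ y)) ⟩
  x * (y * 1/ y)   ≡⟨ sym (ℚₚ.*-assoc x y (1/ y)) ⟩
  (x * y) * 1/ y   ≡⟨ cong (_* 1/ y) xy≡0 ⟩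
  0ℚ * 1/ y        ≡⟨ ℚₚ.*-zeroˡ (1/ y) ⟩
  0ℚ               ∎))
  where open ≡-Reasoning
        instance _ = ℚ.≢-nonZero y≢0

[2+k]*c≡k*c⇒c≡0 : ∀ k c → fromℕ (2 ℕ.+ k) * c ≡ fromℕ k * c → c ≡ 0ℚ
[2+k]*c≡k*c⇒c≡0 k c eq = begin
  c                                              ≡⟨ halve (fromℕ k) c ⟩
  ½ * ((1ℚ + (1ℚ + fromℕ k)) * c - fromℕ k * c)  ≡⟨ cong (λ t → ½ * (t - fromℕ k * c)) eq ⟩
  ½ * (fromℕ k * c - fromℕ k * c)                ≡⟨ cong (½ *_) (ℚₚ.+-inverseʳ (fromℕ k * c)) ⟩
  0ℚ                                             ∎
  where
  open ≡-Reasoning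
  halve : ∀ K c → c ≡ ½ * ((1ℚ + (1ℚ + K)) * c - K * c)
  halve = ℚS.solve 2 (λ K c → let open ℚS in c := con ½ :* ((con 1ℚ :+ (con 1ℚ :+ K)) :* c :- K :* c)) refl

[2+k]*c≡-k*c⇒c≡0 : ∀ k c → fromℕ (2 ℕ.+ k) * c ≡ - (fromℕ k * c) → c ≡ 0ℚ
[2+k]*c≡-k*c⇒c≡0 k c eq = x*y≡0⇒y≡0 (fromℕ (2 ℕ.+ k ℕ.+ k)) c (fromℕ-suc-≢0 (1 ℕ.+ k ℕ.+ k)) (begin
  fromℕ (2 ℕ.+ k ℕ.+ k) * c                  ≡⟨ cong (_* c) (fromℕ-+ (2 ℕ.+ k) k) ⟩
  (fromℕ (2 ℕ.+ k) + fromℕ k) * c            ≡⟨ ℚₚ.*-distribʳ-+ c (fromℕ (2 ℕ.+ k)) (fromℕ k) ⟩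
  fromℕ (2 ℕ.+ k) * c + fromℕ k * c          ≡⟨ cong (_+ fromℕ k * c) eq ⟩
  - (fromℕ k * c) + fromℕ k * c              ≡⟨ ℚₚ.+-inverseˡ (fromℕ k * c) ⟩
  0ℚ                                         ∎)
  where open ≡-Reasoning

-- M as a vector space over ℚ

coord-⊕ : ∀ x y n → coord (x ⊕ y) n ≡ coord x n + coord y n
coord-⊕ []      y       n       = sym (ℚₚ.+-identityˡ _)
coord-⊕ (p ∷ x) []      n       = sym (ℚₚ.+-identityʳ _)
coord-⊕ (p ∷ x) (q ∷ y) zero    = refl
coord-⊕ (p ∷ x) (q ∷ y) (suc n) = coord-⊕ x y n

coord-⊖ : ∀ x n → coord (⊖ x) n ≡ - coord x n
coord-⊖ []      n       = refl
coord-⊖ (p ∷ x) zero    = refl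
coord-⊖ (p ∷ x) (suc n) = coord-⊖ x n

coord-· : ∀ c x n → coord (c · x) n ≡ c * coord x n
coord-· c []      n       = sym (ℚₚ.*-zeroʳ c)
coord-· c (p ∷ x) zero    = refl
coord-· c (p ∷ x) (suc n) = coord-· c x n

-- x ≈ y is a Π-type from which x and y cannot be recovered by unification;
-- the record wrapper makes them inferable.
infix 4 _≋_
record _≋_ (x y : M) : Set where
  constructor ⟨_⟩
  field ≋⇒≈ : x ≈ y
open _≋_

≋-refl : ∀ {x} → x ≋ x
≋-refl = ⟨ (λ n → refl) ⟩

≋-sym : ∀ {x y} → x ≋ y → y ≋ x
≋-sym ⟨ h ⟩ = ⟨ (λ n → sym (h n)) ⟩

≋-trans : ∀ {x y z} → x ≋ y → y ≋ z → x ≋ z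
≋-trans ⟨ h ⟩ ⟨ k ⟩ = ⟨ (λ n → trans (h n) (k n)) ⟩

module _ (π : Perm) where

  to-cong-≋ : ∀ {x y} → x ≋ y → to π x ≋ to π y
  to-cong-≋ ⟨ h ⟩ = ⟨ to-cong π h ⟩

  from-cong-≋ : ∀ {x y} → x ≋ y → from π x ≋ from π y
  from-cong-≋ ⟨ h ⟩ = ⟨ from-cong π h ⟩

  to-from-≋ : ∀ y → to π (from π y) ≋ y
  to-from-≋ y = ⟨ to-from π y ⟩

  from-to-≋ : ∀ x → from π (to π x) ≋ x
  from-to-≋ x = ⟨ from-to π x ⟩

⊕-cong : ∀ {x x′ y y′} → x ≋ x′ → y ≋ y′ → x ⊕ y ≋ x′ ⊕ y′
⊕-cong {x} {x′} {y} {y′} ⟨ h ⟩ ⟨ k ⟩ = ⟨ (λ n →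
  trans (coord-⊕ x y n) (trans (cong₂ _+_ (h n) (k n)) (sym (coord-⊕ x′ y′ n)))) ⟩

⊖-cong : ∀ {x x′} → x ≋ x′ → ⊖ x ≋ ⊖ x′
⊖-cong {x} {x′} ⟨ h ⟩ = ⟨ (λ n →
  trans (coord-⊖ x n) (trans (cong -_ (h n)) (sym (coord-⊖ x′ n)))) ⟩

·-congʳ : ∀ c {x x′} → x ≋ x′ → c · x ≋ c · x′
·-congʳ c {x} {x′} ⟨ h ⟩ = ⟨ (λ n →
  trans (coord-· c x n) (trans (cong (c *_) (h n)) (sym (coord-· c x′ n)))) ⟩

·-congˡ : ∀ {a b} x → a ≡ b → a · x ≋ b · x
·-congˡ x refl = ≋-refl

·-assoc : ∀ a b x → a · (b · x) ≋ (a * b) · x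
·-assoc a b x = ⟨ (λ n → begin
  coord (a · (b · x)) n  ≡⟨ coord-· a (b · x) n ⟩
  a * coord (b · x) n    ≡⟨ cong (a *_) (coord-· b x n) ⟩
  a * (b * coord x n)    ≡⟨ sym (ℚₚ.*-assoc a b (coord x n)) ⟩
  (a * b) * coord x n    ≡⟨ sym (coord-· (a * b) x n) ⟩
  coord ((a * b) · x) n  ∎) ⟩
  where open ≡-Reasoning

·-identityˡ : ∀ x → 1ℚ · x ≋ x
·-identityˡ x = ⟨ (λ n → trans (coord-· 1ℚ x n) (ℚₚ.*-identityˡ (coord x n))) ⟩

·-·-inverseʳ : ∀ a .{{_ : ℚ.NonZero a}} x → a · ((1/ a) · x) ≋ x
·-·-inverseʳ a x = ≋-trans (·-assoc a (1/ a) x) (≋-trans (·-congˡ x (ℚₚ.*-inverseʳ a)) (·-identityˡ x))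

·-·-inverseˡ : ∀ a .{{_ : ℚ.NonZero a}} x → (1/ a) · (a · x) ≋ x
·-·-inverseˡ a x = ≋-trans (·-assoc (1/ a) a x) (≋-trans (·-congˡ x (ℚₚ.*-inverseˡ a)) (·-identityˡ x))

·-zeroˡ : ∀ x → 0ℚ · x ≋ []
·-zeroˡ x = ⟨ (λ n → trans (coord-· 0ℚ x n) (ℚₚ.*-zeroˡ (coord x n))) ⟩

-‿· : ∀ a x → (- a) · x ≋ ⊖ (a · x)
-‿· a x = ⟨ (λ n → begin
  coord ((- a) · x) n  ≡⟨ coord-· (- a) x n ⟩
  - a * coord x n      ≡⟨ sym (ℚₚ.neg-distribˡ-* a (coord x n)) ⟩
  - (a * coord x n)    ≡⟨ cong -_ (sym (coord-· a x n)) ⟩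
  - coord (a · x) n    ≡⟨ sym (coord-⊖ (a · x) n) ⟩
  coord (⊖ (a · x)) n  ∎) ⟩
  where open ≡-Reasoning

·-⊖ : ∀ a x → a · (⊖ x) ≋ ⊖ (a · x)
·-⊖ a x = ⟨ (λ n → begin
  coord (a · (⊖ x)) n  ≡⟨ coord-· a (⊖ x) n ⟩
  a * coord (⊖ x) n    ≡⟨ cong (a *_) (coord-⊖ x n) ⟩
  a * - coord x n      ≡⟨ sym (ℚₚ.neg-distribʳ-* a (coord x n)) ⟩
  - (a * coord x n)    ≡⟨ cong -_ (sym (coord-· a x n)) ⟩
  - coord (a · x) n    ≡⟨ sym (coord-⊖ (a · x) n) ⟩
  coord (⊖ (a · x)) n  ∎) ⟩
  where open ≡-Reasoning

·-distribˡ-⊕ : ∀ a x y → a · (x ⊕ y) ≋ a · x ⊕ a · y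
·-distribˡ-⊕ a x y = ⟨ (λ n → begin
  coord (a · (x ⊕ y)) n              ≡⟨ coord-· a (x ⊕ y) n ⟩
  a * coord (x ⊕ y) n                ≡⟨ cong (a *_) (coord-⊕ x y n) ⟩
  a * (coord x n + coord y n)        ≡⟨ ℚₚ.*-distribˡ-+ a (coord x n) (coord y n) ⟩
  a * coord x n + a * coord y n      ≡⟨ sym (cong₂ _+_ (coord-· a x n) (coord-· a y n)) ⟩
  coord (a · x) n + coord (a · y) n  ≡⟨ sym (coord-⊕ (a · x) (a · y) n) ⟩
  coord (a · x ⊕ a · y) n            ∎) ⟩
  where open ≡-Reasoning

·-distribʳ-+ : ∀ a b x → (a + b) · x ≋ a · x ⊕ b · x
·-distribʳ-+ a b x = ⟨ (λ n → begin
  coord ((a + b) · x) n              ≡⟨ coord-· (a + b) x n ⟩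
  (a + b) * coord x n                ≡⟨ ℚₚ.*-distribʳ-+ (coord x n) a b ⟩
  a * coord x n + b * coord x n      ≡⟨ sym (cong₂ _+_ (coord-· a x n) (coord-· b x n)) ⟩
  coord (a · x) n + coord (b · x) n  ≡⟨ sym (coord-⊕ (a · x) (b · x) n) ⟩
  coord (a · x ⊕ b · x) n            ∎) ⟩
  where open ≡-Reasoning

tailᴹ : M → M
tailᴹ []      = []
tailᴹ (_ ∷ x) = x

coord-suc : ∀ x n → coord x (suc n) ≡ coord (tailᴹ x) n
coord-suc []      n = refl
coord-suc (_ ∷ x) n = refl

≈-by-head-tail? : ∀ x y → Dec (coord x 0 ≡ coord y 0) → Dec (tailᴹ x ≈ tailᴹ y) → Dec (x ≈ y)
≈-by-head-tail? x y (no ¬h)  _        = no (λ x≈y → ¬h (x≈y 0))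
≈-by-head-tail? x y (yes _)  (no ¬t)  = no (λ x≈y → ¬t (λ n →
  trans (sym (coord-suc x n)) (trans (x≈y (suc n)) (coord-suc y n))))
≈-by-head-tail? x y (yes h₀) (yes t) = yes λ where
  zero    → h₀
  (suc n) → trans (coord-suc x n) (trans (t n) (sym (coord-suc y n)))

infix 4 _≈?_ _≋?_
_≈?_ : (x y : M) → Dec (x ≈ y)
[]      ≈? []      = yes (λ n → refl)
[]      ≈? (q ∷ y) = ≈-by-head-tail? [] (q ∷ y) (0ℚ ℚ.≟ q) ([] ≈? y)
(p ∷ x) ≈? []      = ≈-by-head-tail? (p ∷ x) [] (p ℚ.≟ 0ℚ) (x ≈? [])
(p ∷ x) ≈? (q ∷ y) = ≈-by-head-tail? (p ∷ x) (q ∷ y) (p ℚ.≟ q) (x ≈? y)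

_≋?_ : (x y : M) → Dec (x ≋ y)
x ≋? y = Dec.map′ ⟨_⟩ ≋⇒≈ (x ≈? y)

-- Identities between linear expressions in vectors of M are decided by
-- comparing coefficient vectors (which are themselves elements of M).
infixl 6 _⊞_
data Expr : Set where
  var : ℕ → Expr
  _⊞_ : Expr → Expr → Expr
  ⊟_  : Expr → Expr
  _⊡_ : ℚ → Expr → Expr
  𝟘   : Expr

#0 #1 #2 #3 : Expr
#0 = var 0
#1 = var 1
#2 = var 2
#3 = var 3

Env : Set
Env = ℕ → M

⟦_⟧ : Expr → Env → M
⟦ var i ⟧ ρ = ρ i
⟦ e ⊞ f ⟧ ρ = ⟦ e ⟧ ρ ⊕ ⟦ f ⟧ ρ
⟦ ⊟ e ⟧   ρ = ⊖ ⟦ e ⟧ ρ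
⟦ c ⊡ e ⟧ ρ = c · ⟦ e ⟧ ρ
⟦ 𝟘 ⟧     ρ = []

basis : ℕ → M
basis zero    = 1ℚ ∷ []
basis (suc i) = 0ℚ ∷ basis i

coefficients : Expr → M
coefficients (var i) = basis i
coefficients (e ⊞ f) = coefficients e ⊕ coefficients f
coefficients (⊟ e)   = ⊖ coefficients e
coefficients (c ⊡ e) = c · coefficients e
coefficients 𝟘       = []

combination : M → Env → ℕ → ℚ
combination []       ρ n = 0ℚ
combination (c ∷ cs) ρ n = c * coord (ρ 0) n + combination cs (ρ ∘ suc) n

combination-⊕ : ∀ cs ds ρ n → combination (cs ⊕ ds) ρ n ≡ combination cs ρ n + combination ds ρ n
combination-⊕ []       ds       ρ n = sym (ℚₚ.+-identityˡ _)
combination-⊕ (c ∷ cs) []       ρ n = sym (ℚₚ.+-identityʳ _)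
combination-⊕ (c ∷ cs) (d ∷ ds) ρ n rewrite combination-⊕ cs ds (ρ ∘ suc) n =
  ℚS.solve 5 (λ c d X A B → let open ℚS in (c :+ d) :* X :+ (A :+ B) := (c :* X :+ A) :+ (d :* X :+ B)) refl
    c d (coord (ρ 0) n) (combination cs (ρ ∘ suc) n) (combination ds (ρ ∘ suc) n)

combination-⊖ : ∀ cs ρ n → combination (⊖ cs) ρ n ≡ - combination cs ρ n
combination-⊖ []       ρ n = refl
combination-⊖ (c ∷ cs) ρ n rewrite combination-⊖ cs (ρ ∘ suc) n =
  ℚS.solve 3 (λ c X A → let open ℚS in (:- c) :* X :+ (:- A) := :- (c :* X :+ A)) refl
    c (coord (ρ 0) n) (combination cs (ρ ∘ suc) n)

combination-· : ∀ k cs ρ n → combination (k · cs) ρ n ≡ k * combination cs ρ n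
combination-· k []       ρ n = sym (ℚₚ.*-zeroʳ k)
combination-· k (c ∷ cs) ρ n rewrite combination-· k cs (ρ ∘ suc) n =
  ℚS.solve 4 (λ k c X A → let open ℚS in (k :* c) :* X :+ (k :* A) := k :* (c :* X :+ A)) refl
    k c (coord (ρ 0) n) (combination cs (ρ ∘ suc) n)

combination-basis : ∀ i ρ n → combination (basis i) ρ n ≡ coord (ρ i) n
combination-basis zero    ρ n = ℚS.solve 1 (λ X → let open ℚS in con 1ℚ :* X :+ con 0ℚ := X) refl (coord (ρ 0) n)
combination-basis (suc i) ρ n rewrite combination-basis i (ρ ∘ suc) n =
  ℚS.solve 2 (λ Y X → let open ℚS in con 0ℚ :* Y :+ X := X) refl (coord (ρ 0) n) (coord (ρ (suc i)) n)

combination-cong : ∀ cs ds ρ n → cs ≈ ds → combination cs ρ n ≡ combination ds ρ n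
combination-cong cs ds ρ n cs≈ds = go cs ds ρ cs≈ds
  where
  0*X+0 : ∀ X → 0ℚ * X + 0ℚ ≡ 0ℚ
  0*X+0 X = ℚS.solve 1 (λ X → let open ℚS in con 0ℚ :* X :+ con 0ℚ := con 0ℚ) refl X
  go : ∀ cs ds ρ → cs ≈ ds → combination cs ρ n ≡ combination ds ρ n
  go []       []       ρ h = refl
  go []       (d ∷ ds) ρ h rewrite sym (h 0) | sym (go [] ds (ρ ∘ suc) (h ∘ suc)) = sym (0*X+0 (coord (ρ 0) n))
  go (c ∷ cs) []       ρ h rewrite h 0 | go cs [] (ρ ∘ suc) (h ∘ suc) = 0*X+0 (coord (ρ 0) n)
  go (c ∷ cs) (d ∷ ds) ρ h rewrite h 0 | go cs ds (ρ ∘ suc) (h ∘ suc) = refl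

coord-⟦⟧ : ∀ e ρ n → coord (⟦ e ⟧ ρ) n ≡ combination (coefficients e) ρ n
coord-⟦⟧ (var i) ρ n = sym (combination-basis i ρ n)
coord-⟦⟧ (e ⊞ f) ρ n = trans (coord-⊕ (⟦ e ⟧ ρ) (⟦ f ⟧ ρ) n)
  (trans (cong₂ _+_ (coord-⟦⟧ e ρ n) (coord-⟦⟧ f ρ n)) (sym (combination-⊕ (coefficients e) (coefficients f) ρ n)))
coord-⟦⟧ (⊟ e)   ρ n = trans (coord-⊖ (⟦ e ⟧ ρ) n)
  (trans (cong -_ (coord-⟦⟧ e ρ n)) (sym (combination-⊖ (coefficients e) ρ n)))
coord-⟦⟧ (c ⊡ e) ρ n = trans (coord-· c (⟦ e ⟧ ρ) n)
  (trans (cong (c *_) (coord-⟦⟧ e ρ n)) (sym (combination-· c (coefficients e) ρ n)))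
coord-⟦⟧ 𝟘       ρ n = refl

env : List M → Env
env []       i       = []
env (x ∷ xs) zero    = x
env (x ∷ xs) (suc i) = env xs i

solve : ∀ e f (xs : List M) → {True (coefficients e ≈? coefficients f)} → ⟦ e ⟧ (env xs) ≋ ⟦ f ⟧ (env xs)
solve e f xs {same} = ⟨ (λ n → trans (coord-⟦⟧ e (env xs) n)
  (trans (combination-cong (coefficients e) (coefficients f) (env xs) n (toWitness same))
         (sym (coord-⟦⟧ f (env xs) n)))) ⟩

infix 4 _≈±_
_≈±_ : M → M → Set
x ≈± y = x ≋ y ⊎ x ≋ ⊖ y

⊖-involutive : ∀ x → ⊖ ⊖ x ≋ x
⊖-involutive x = solve (⊟ ⊟ #0) #0 (x ∷ [])

≈±-refl : ∀ {x} → x ≈± x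
≈±-refl = inj₁ ≋-refl

≈±-sym : ∀ {x y} → x ≈± y → y ≈± x
≈±-sym         (inj₁ h) = inj₁ (≋-sym h)
≈±-sym {y = y} (inj₂ h) = inj₂ (≋-trans (≋-sym (⊖-involutive y)) (⊖-cong (≋-sym h)))

≈±-trans : ∀ {x y z} → x ≈± y → y ≈± z → x ≈± z
≈±-trans         (inj₁ h) (inj₁ k) = inj₁ (≋-trans h k)
≈±-trans         (inj₁ h) (inj₂ k) = inj₂ (≋-trans h k)
≈±-trans         (inj₂ h) (inj₁ k) = inj₂ (≋-trans h (⊖-cong k))
≈±-trans {z = z} (inj₂ h) (inj₂ k) = inj₁ (≋-trans h (≋-trans (⊖-cong k) (⊖-involutive z)))

≈±-setoid : Setoid 0ℓ 0ℓ
≈±-setoid = record { Carrier = M ; _≈_ = _≈±_ ; isEquivalence = record { refl = ≈±-refl ; sym = ≈±-sym ; trans = ≈±-trans } }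

module ≈±-Reasoning = SetoidReasoning ≈±-setoid

infix 4 _≈±?_
_≈±?_ : (x y : M) → Dec (x ≈± y)
x ≈±? y = (x ≋? y) ⊎-dec (x ≋? ⊖ y)

≋-≈±-trans : ∀ {x y z} → x ≋ y → y ≈± z → x ≈± z
≋-≈±-trans h = ≈±-trans (inj₁ h)

≈±-≋-trans : ∀ {x y z} → x ≈± y → y ≋ z → x ≈± z
≈±-≋-trans h k = ≈±-trans h (inj₁ k)

⊖x≈±x : ∀ x → ⊖ x ≈± x
⊖x≈±x x = inj₂ ≋-refl

signed : ∀ {P : Set} → Dec P → M → M
signed (yes _) x = x
signed (no  _) x = ⊖ x

signed-≈± : ∀ {P : Set} (p? : Dec P) x → signed p? x ≈± x
signed-≈± (yes _) x = ≈±-refl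
signed-≈± (no  _) x = ⊖x≈±x x

·-cong-≈± : ∀ c {x y} → x ≈± y → c · x ≈± c · y
·-cong-≈± c         (inj₁ h) = inj₁ (·-congʳ c h)
·-cong-≈± c {y = y} (inj₂ h) = inj₂ (≋-trans (·-congʳ c h) (·-⊖ c y))

≈±-[] : ∀ {x y} → x ≈± y → y ≋ [] → x ≋ []
≈±-[] (inj₁ h) y≋0 = ≋-trans h y≋0
≈±-[] (inj₂ h) y≋0 = ≋-trans h (⊖-cong y≋0)

multiple-of-[] : ∀ {x y} k → x ≋ k · y → y ≋ [] → x ≋ []
multiple-of-[] k x≋ky y≋0 = ≋-trans x≋ky (·-congʳ k y≋0)

≋⇒difference-[] : ∀ {x y} → x ≋ y → x ⊕ ⊖ y ≋ []
≋⇒difference-[] {y = y} x≋y = ≋-trans (⊕-cong x≋y ≋-refl) (solve (#0 ⊞ ⊟ #0) 𝟘 (y ∷ []))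

≈±-common : ∀ {d x y} → d ≈± x → d ≈± y → (x ⊕ ⊖ y ≋ []) ⊎ (x ⊕ y ≋ [])
≈±-common {d} d±x d±y with ≈±-sym d±x | ≈±-sym d±y
... | inj₁ p | inj₁ q = inj₁ (≋-trans (⊕-cong p (⊖-cong q)) (solve (#0 ⊞ ⊟ #0) 𝟘 (d ∷ [])))
... | inj₁ p | inj₂ q = inj₂ (≋-trans (⊕-cong p q) (solve (#0 ⊞ ⊟ #0) 𝟘 (d ∷ [])))
... | inj₂ p | inj₁ q = inj₂ (≋-trans (⊕-cong p q) (solve (⊟ #0 ⊞ #0) 𝟘 (d ∷ [])))
... | inj₂ p | inj₂ q = inj₁ (≋-trans (⊕-cong p (⊖-cong q)) (solve (⊟ #0 ⊞ ⊟ ⊟ #0) 𝟘 (d ∷ [])))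

T± : M → M → M → Set
T± x y z = z ≈± x ⊕ y ⊎ z ≈± x ⊕ ⊖ y

T⇒T± : ∀ {x y z} → T x y z → T± x y z
T⇒T±         (inj₁ h)               = inj₁ (inj₁ ⟨ h ⟩)
T⇒T±         (inj₂ (inj₁ h))        = inj₂ (inj₁ ⟨ h ⟩)
T⇒T± {x} {y} (inj₂ (inj₂ (inj₁ h))) = inj₂ (inj₂ (≋-trans ⟨ h ⟩ (solve (⊟ #0 ⊞ #1) (⊟ (#0 ⊞ ⊟ #1)) (x ∷ y ∷ []))))
T⇒T± {x} {y} (inj₂ (inj₂ (inj₂ h))) = inj₁ (inj₂ (≋-trans ⟨ h ⟩ (solve (⊟ #0 ⊞ ⊟ #1) (⊟ (#0 ⊞ #1)) (x ∷ y ∷ []))))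

T±⇒T : ∀ {x y z} → T± x y z → T x y z
T±⇒T         (inj₁ (inj₁ h)) = inj₁ (≋⇒≈ h)
T±⇒T         (inj₂ (inj₁ h)) = inj₂ (inj₁ (≋⇒≈ h))
T±⇒T {x} {y} (inj₂ (inj₂ h)) = inj₂ (inj₂ (inj₁ (≋⇒≈ (≋-trans h (solve (⊟ (#0 ⊞ ⊟ #1)) (⊟ #0 ⊞ #1) (x ∷ y ∷ []))))))
T±⇒T {x} {y} (inj₁ (inj₂ h)) = inj₂ (inj₂ (inj₂ (≋⇒≈ (≋-trans h (solve (⊟ (#0 ⊞ #1)) (⊟ #0 ⊞ ⊟ #1) (x ∷ y ∷ []))))))

⊕-⊖-≈± : ∀ {x x′ y y′} → x ≈± x′ → y ≈± y′ →
  (x ⊕ y ≈± x′ ⊕ y′ × x ⊕ ⊖ y ≈± x′ ⊕ ⊖ y′) ⊎ (x ⊕ y ≈± x′ ⊕ ⊖ y′ × x ⊕ ⊖ y ≈± x′ ⊕ y′)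
⊕-⊖-≈±                     (inj₁ h) (inj₁ k) = inj₁ (inj₁ (⊕-cong h k) , inj₁ (⊕-cong h (⊖-cong k)))
⊕-⊖-≈± {x′ = x′} {y′ = y′} (inj₁ h) (inj₂ k) = inj₂ (inj₁ (⊕-cong h k) ,
  inj₁ (≋-trans (⊕-cong h (⊖-cong k)) (solve (#0 ⊞ ⊟ ⊟ #1) (#0 ⊞ #1) (x′ ∷ y′ ∷ []))))
⊕-⊖-≈± {x′ = x′} {y′ = y′} (inj₂ h) (inj₁ k) = inj₂
  (inj₂ (≋-trans (⊕-cong h k) (solve (⊟ #0 ⊞ #1) (⊟ (#0 ⊞ ⊟ #1)) (x′ ∷ y′ ∷ []))) ,
   inj₂ (≋-trans (⊕-cong h (⊖-cong k)) (solve (⊟ #0 ⊞ ⊟ #1) (⊟ (#0 ⊞ #1)) (x′ ∷ y′ ∷ []))))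
⊕-⊖-≈± {x′ = x′} {y′ = y′} (inj₂ h) (inj₂ k) = inj₁
  (inj₂ (≋-trans (⊕-cong h k) (solve (⊟ #0 ⊞ ⊟ #1) (⊟ (#0 ⊞ #1)) (x′ ∷ y′ ∷ []))) ,
   inj₂ (≋-trans (⊕-cong h (⊖-cong k)) (solve (⊟ #0 ⊞ ⊟ ⊟ #1) (⊟ (#0 ⊞ ⊟ #1)) (x′ ∷ y′ ∷ []))))

T±-resp : ∀ {x x′ y y′ z z′} → x ≈± x′ → y ≈± y′ → z ≈± z′ → T± x y z → T± x′ y′ z′
T±-resp hx hy hz t with ⊕-⊖-≈± hx hy | t
... | inj₁ (p , q) | inj₁ t = inj₁ (≈±-trans (≈±-sym hz) (≈±-trans t p))
... | inj₁ (p , q) | inj₂ t = inj₂ (≈±-trans (≈±-sym hz) (≈±-trans t q))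
... | inj₂ (p , q) | inj₁ t = inj₂ (≈±-trans (≈±-sym hz) (≈±-trans t p))
... | inj₂ (p , q) | inj₂ t = inj₁ (≈±-trans (≈±-sym hz) (≈±-trans t q))

Degenerate : M → M → M → Set
Degenerate a b c = a ≋ [] ⊎ b ≋ [] ⊎ c ≋ [] ⊎ a ⊕ b ≋ [] ⊎ a ⊕ c ≋ [] ⊎ b ⊕ ⊖ c ≋ []

cancel-≈± : ∀ {d x y u v} k l → u ≋ k · (x ⊕ ⊖ y) → v ≋ l · (x ⊕ y) → d ≈± x → d ≈± y → u ≋ [] ⊎ v ≋ []
cancel-≈± k l u≋ v≋ d±x d±y with ≈±-common d±x d±y
... | inj₁ x-y≋0 = inj₁ (multiple-of-[] k u≋ x-y≋0)
... | inj₂ x+y≋0 = inj₂ (multiple-of-[] l v≋ x+y≋0)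

T±-three-ways⇒degenerate : ∀ a b c d → T± (a ⊕ b) c d → T± (a ⊕ c) b d → T± a (b ⊕ ⊖ c) d → Degenerate a b c
T±-three-ways⇒degenerate a b c d = go
  where
  ρ = a ∷ b ∷ c ∷ []
  a+b+c a+b-c a+c+b a+c-b a+[b-c] a-[b-c] : Expr
  a+b+c   = (#0 ⊞ #1) ⊞ #2
  a+b-c   = (#0 ⊞ #1) ⊞ ⊟ #2
  a+c+b   = (#0 ⊞ #2) ⊞ #1
  a+c-b   = (#0 ⊞ #2) ⊞ ⊟ #1
  a+[b-c] = #0 ⊞ (#1 ⊞ ⊟ #2)
  a-[b-c] = #0 ⊞ ⊟ (#1 ⊞ ⊟ #2)
  a≋0 : a ≋ [] → Degenerate a b c
  a≋0 = inj₁
  b≋0 : b ≋ [] → Degenerate a b c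
  b≋0 = inj₂ ∘ inj₁
  c≋0 : c ≋ [] → Degenerate a b c
  c≋0 = inj₂ ∘ inj₂ ∘ inj₁
  a+b≋0 : a ⊕ b ≋ [] → Degenerate a b c
  a+b≋0 = inj₂ ∘ inj₂ ∘ inj₂ ∘ inj₁
  a+c≋0 : a ⊕ c ≋ [] → Degenerate a b c
  a+c≋0 = inj₂ ∘ inj₂ ∘ inj₂ ∘ inj₂ ∘ inj₁
  b-c≋0 : b ⊕ ⊖ c ≋ [] → Degenerate a b c
  b-c≋0 = inj₂ ∘ inj₂ ∘ inj₂ ∘ inj₂ ∘ inj₂
  go : T± (a ⊕ b) c d → T± (a ⊕ c) b d → T± a (b ⊕ ⊖ c) d → Degenerate a b c
  go (inj₁ p) (inj₁ q) (inj₁ r) = Sum.[ c≋0 , a+b≋0 ]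
    (cancel-≈± ½ ½ (solve #2 (½ ⊡ (a+b+c ⊞ ⊟ a+[b-c])) ρ) (solve (#0 ⊞ #1) (½ ⊡ (a+b+c ⊞ a+[b-c])) ρ) p r)
  go (inj₁ p) (inj₁ q) (inj₂ r) = Sum.[ b≋0 , a+c≋0 ]
    (cancel-≈± ½ ½ (solve #1 (½ ⊡ (a+b+c ⊞ ⊟ a-[b-c])) ρ) (solve (#0 ⊞ #2) (½ ⊡ (a+b+c ⊞ a-[b-c])) ρ) p r)
  go (inj₁ p) (inj₂ q) _        = Sum.[ b≋0 , a+c≋0 ]
    (cancel-≈± ½ ½ (solve #1 (½ ⊡ (a+b+c ⊞ ⊟ a+c-b)) ρ) (solve (#0 ⊞ #2) (½ ⊡ (a+b+c ⊞ a+c-b)) ρ) p q)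
  go (inj₂ p) (inj₁ q) _        = Sum.[ c≋0 , a+b≋0 ]
    (cancel-≈± -½ ½ (solve #2 (-½ ⊡ (a+b-c ⊞ ⊟ a+c+b)) ρ) (solve (#0 ⊞ #1) (½ ⊡ (a+b-c ⊞ a+c+b)) ρ) p q)
  go (inj₂ p) (inj₂ q) _        = Sum.[ b-c≋0 , a≋0 ]
    (cancel-≈± ½ ½ (solve (#1 ⊞ ⊟ #2) (½ ⊡ (a+b-c ⊞ ⊟ a+c-b)) ρ) (solve #0 (½ ⊡ (a+b-c ⊞ a+c-b)) ρ) p q)

T±-diagonal⇒[] : ∀ {x} → T± x x x → x ≋ []
T±-diagonal⇒[] {x} (inj₁ (inj₁ h)) = multiple-of-[] (- 1ℚ)    (solve #0 ((- 1ℚ) ⊡ (#0 ⊞ ⊟ (#0 ⊞ #0))) (x ∷ [])) (≋⇒difference-[] h)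
T±-diagonal⇒[] {x} (inj₁ (inj₂ h)) = multiple-of-[] (+ 1 ℚ./ 3) (solve #0 ((+ 1 ℚ./ 3) ⊡ (#0 ⊞ ⊟ ⊟ (#0 ⊞ #0))) (x ∷ [])) (≋⇒difference-[] h)
T±-diagonal⇒[] {x} (inj₂ (inj₁ h)) = multiple-of-[] 1ℚ        (solve #0 (1ℚ ⊡ (#0 ⊞ ⊟ (#0 ⊞ ⊟ #0))) (x ∷ [])) (≋⇒difference-[] h)
T±-diagonal⇒[] {x} (inj₂ (inj₂ h)) = multiple-of-[] 1ℚ        (solve #0 (1ℚ ⊡ (#0 ⊞ ⊟ ⊟ (#0 ⊞ ⊟ #0))) (x ∷ [])) (≋⇒difference-[] h)

T±-[]⇒≈± : ∀ {x z} → T± x [] z → z ≈± x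
T±-[]⇒≈± {x} (inj₁ h) = ≈±-≋-trans h (solve (#0 ⊞ 𝟘) #0 (x ∷ []))
T±-[]⇒≈± {x} (inj₂ h) = ≈±-≋-trans h (solve (#0 ⊞ ⊟ 𝟘) #0 (x ∷ []))

≈±⇒T±-[] : ∀ {x z} → z ≈± x → T± x [] z
≈±⇒T±-[] {x} h = inj₁ (≈±-≋-trans h (solve #0 (#0 ⊞ 𝟘) (x ∷ [])))

fromℕ-suc-· : ∀ k x → fromℕ (suc k) · x ≋ fromℕ k · x ⊕ x
fromℕ-suc-· k x = ≋-trans (·-distribʳ-+ 1ℚ (fromℕ k) x)
  (≋-trans (⊕-cong (·-identityˡ x) ≋-refl) (solve (#0 ⊞ #1) (#1 ⊞ #0) (x ∷ fromℕ k · x ∷ [])))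

fromℕ-suc-·-⊖ : ∀ k x → fromℕ (suc k) · x ⊕ ⊖ x ≋ fromℕ k · x
fromℕ-suc-·-⊖ k x = ≋-trans (⊕-cong (fromℕ-suc-· k x) ≋-refl) (solve ((#0 ⊞ #1) ⊞ ⊟ #1) #0 (fromℕ k · x ∷ x ∷ []))

fromℕ-1-· : ∀ x → fromℕ 1 · x ≋ x
fromℕ-1-· x = ≋-trans (fromℕ-suc-· 0 x) (⊕-cong (·-zeroˡ x) ≋-refl)

[2+k]·x≈±k·x⇒x≋[] : ∀ k x → fromℕ (2 ℕ.+ k) · x ≈± fromℕ k · x → x ≋ []
[2+k]·x≈±k·x⇒x≋[] k x (inj₁ ⟨ h ⟩) = ⟨ (λ n → [2+k]*c≡k*c⇒c≡0 k (coord x n)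
  (trans (sym (coord-· (fromℕ (2 ℕ.+ k)) x n)) (trans (h n) (coord-· (fromℕ k) x n)))) ⟩
[2+k]·x≈±k·x⇒x≋[] k x (inj₂ ⟨ h ⟩) = ⟨ (λ n → [2+k]*c≡-k*c⇒c≡0 k (coord x n)
  (trans (sym (coord-· (fromℕ (2 ℕ.+ k)) x n))
    (trans (h n) (trans (coord-⊖ (fromℕ k · x) n) (cong -_ (coord-· (fromℕ k) x n)))))) ⟩

Nonzero : M → Set
Nonzero x = ¬ (x ≋ [])

-- Supports and the standard basis

length-⊕-≤ : ∀ n x y → length x ℕ.≤ n → length y ℕ.≤ n → length (x ⊕ y) ℕ.≤ n
length-⊕-≤ n       []      y       hx       hy       = hy
length-⊕-≤ n       (p ∷ x) []      hx       hy       = hx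
length-⊕-≤ (suc n) (p ∷ x) (q ∷ y) (s≤s hx) (s≤s hy) = s≤s (length-⊕-≤ n x y hx hy)

length-· : ∀ c x → length (c · x) ≡ length x
length-· c = Listₚ.length-map (c *_)

length-take-≤ : ∀ n (x : M) → length (take n x) ℕ.≤ n
length-take-≤ n x = ℕₚ.≤-trans (ℕₚ.≤-reflexive (Listₚ.length-take n x)) (ℕₚ.m⊓n≤m n (length x))

length≤0⇒≋[] : ∀ (x : M) → length x ℕ.≤ 0 → x ≋ []
length≤0⇒≋[] [] _ = ≋-refl

coord-≥length : ∀ x n → length x ℕ.≤ n → coord x n ≡ 0ℚ
coord-≥length []      n       _       = refl
coord-≥length (p ∷ x) (suc n) (s≤s h) = coord-≥length x n h

coord-basis-self : ∀ n → coord (basis n) n ≡ 1ℚ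
coord-basis-self zero    = refl
coord-basis-self (suc n) = coord-basis-self n

⊕-basis-nonzero : ∀ n x → length x ℕ.≤ n → Nonzero (x ⊕ basis n)
⊕-basis-nonzero n x h ⟨ x⊕eₙ≈0 ⟩ = ℚₚ.1≢0 (begin
  1ℚ                                ≡⟨ sym (ℚₚ.+-identityˡ 1ℚ) ⟩
  0ℚ + 1ℚ                           ≡⟨ sym (cong₂ _+_ (coord-≥length x n h) (coord-basis-self n)) ⟩
  coord x n + coord (basis n) n     ≡⟨ sym (coord-⊕ x (basis n) n) ⟩
  coord (x ⊕ basis n) n             ≡⟨ x⊕eₙ≈0 n ⟩
  0ℚ                                ∎)
  where open ≡-Reasoning

≋-take-⊕-last : ∀ n x → length x ℕ.≤ suc n → x ≋ take n x ⊕ coord x n · basis n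
≋-take-⊕-last zero    []          _       = ⟨ (λ { zero → refl ; (suc i) → refl }) ⟩
≋-take-⊕-last zero    (p ∷ [])    _       = ⟨ (λ { zero → sym (ℚₚ.*-identityʳ p) ; (suc i) → refl }) ⟩
≋-take-⊕-last zero    (p ∷ q ∷ x) (s≤s ())
≋-take-⊕-last (suc n) []          _       = ≋-sym (·-zeroˡ (basis (suc n)))
≋-take-⊕-last (suc n) (p ∷ x)     (s≤s h) with ≋-take-⊕-last n x h
... | ⟨ k ⟩ = ⟨ (λ { zero → trans (sym (ℚₚ.+-identityʳ p)) (cong (_+_ p) (sym (ℚₚ.*-zeroʳ (coord x n))))
                   ; (suc i) → k i }) ⟩

module LinearExtension (e : ℕ → M) where

  extend : ℕ → M → M
  extend i []      = []
  extend i (p ∷ x) = p · e i ⊕ extend (suc i) x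

  extend-≈[] : ∀ i x → [] ≈ x → extend i x ≋ []
  extend-≈[] i []      h = ≋-refl
  extend-≈[] i (q ∷ x) h = ≋-trans
    (⊕-cong (≋-trans (·-congˡ (e i) (sym (h 0))) (·-zeroˡ (e i))) (extend-≈[] (suc i) x (h ∘ suc)))
    ≋-refl

  extend-cong : ∀ i {x y} → x ≋ y → extend i x ≋ extend i y
  extend-cong i {[]}    {y}     ⟨ h ⟩ = ≋-sym (extend-≈[] i y h)
  extend-cong i {p ∷ x} {[]}    ⟨ h ⟩ = extend-≈[] i (p ∷ x) (sym ∘ h)
  extend-cong i {p ∷ x} {q ∷ y} ⟨ h ⟩ = ⊕-cong (·-congˡ (e i) (h 0)) (extend-cong (suc i) {x} {y} ⟨ h ∘ suc ⟩)

  extend-⊕ : ∀ i x y → extend i (x ⊕ y) ≋ extend i x ⊕ extend i y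
  extend-⊕ i []      y       = ≋-refl
  extend-⊕ i (p ∷ x) []      = solve #0 (#0 ⊞ 𝟘) (extend i (p ∷ x) ∷ [])
  extend-⊕ i (p ∷ x) (q ∷ y) = ≋-trans (⊕-cong (·-distribʳ-+ p q (e i)) (extend-⊕ (suc i) x y))
    (solve ((#0 ⊞ #1) ⊞ (#2 ⊞ #3)) ((#0 ⊞ #2) ⊞ (#1 ⊞ #3))
           (p · e i ∷ q · e i ∷ extend (suc i) x ∷ extend (suc i) y ∷ []))

  extend-· : ∀ i c x → extend i (c · x) ≋ c · extend i x
  extend-· i c []      = ≋-refl
  extend-· i c (p ∷ x) = ≋-trans (⊕-cong (≋-sym (·-assoc c p (e i))) (extend-· (suc i) c x))
                                 (≋-sym (·-distribˡ-⊕ c (p · e i) (extend (suc i) x)))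

  extend-⊖ : ∀ i x → extend i (⊖ x) ≋ ⊖ extend i x
  extend-⊖ i []      = ≋-refl
  extend-⊖ i (p ∷ x) = ≋-trans (⊕-cong (-‿· p (e i)) (extend-⊖ (suc i) x))
    (solve (⊟ #0 ⊞ ⊟ #1) (⊟ (#0 ⊞ #1)) (p · e i ∷ extend (suc i) x ∷ []))

  extend-basis : ∀ i n → extend i (basis n) ≋ e (i ℕ.+ n)
  extend-basis i zero    rewrite ℕₚ.+-identityʳ i =
    ≋-trans (⊕-cong (·-identityˡ (e i)) ≋-refl) (solve (#0 ⊞ 𝟘) #0 (e i ∷ []))
  extend-basis i (suc n) rewrite ℕₚ.+-suc i n =
    ≋-trans (⊕-cong (·-zeroˡ (e i)) (extend-basis (suc i) n)) ≋-refl

  Λ : M → M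
  Λ = extend 0

T±-Homo : (M → M) → Set
T±-Homo f = ∀ {x y z} → T± x y z → T± (f x) (f y) (f z)

PreservesT± : (M → M) → Set
PreservesT± f = ∀ x y z → (T± x y z → T± (f x) (f y) (f z)) × (T± (f x) (f y) (f z) → T± x y z)

PreservesT⇒PreservesT± : ∀ σ → PreservesT σ → PreservesT± (to σ)
PreservesT⇒PreservesT± σ σ-pres x y z =
  T⇒T± {to σ x} {to σ y} {to σ z} ∘ proj₁ (σ-pres x y z) ∘ T±⇒T {x} {y} {z} ,
  T⇒T± {x} {y} {z} ∘ proj₂ (σ-pres x y z) ∘ T±⇒T {to σ x} {to σ y} {to σ z}

PreservesT±⇒PreservesT : ∀ σ → PreservesT± (to σ) → PreservesT σ
PreservesT±⇒PreservesT σ σ-pres x y z =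
  T±⇒T {to σ x} {to σ y} {to σ z} ∘ proj₁ (σ-pres x y z) ∘ T⇒T± {x} {y} {z} ,
  T±⇒T {x} {y} {z} ∘ proj₂ (σ-pres x y z) ∘ T⇒T± {to σ x} {to σ y} {to σ z}

PreservesT±-id : PreservesT± id
PreservesT±-id x y z = id , id

PreservesT±-∘ : ∀ {f g} → PreservesT± f → PreservesT± g → PreservesT± (f ∘ g)
PreservesT±-∘ {f} {g} f-pres g-pres x y z =
  proj₁ (f-pres (g x) (g y) (g z)) ∘ proj₁ (g-pres x y z) ,
  proj₂ (g-pres x y z) ∘ proj₂ (f-pres (g x) (g y) (g z))

PreservesT±-resp : ∀ {f g} → (∀ x → f x ≈± g x) → PreservesT± f → PreservesT± g
PreservesT±-resp f≈±g f-pres x y z =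
  T±-resp (f≈±g x) (f≈±g y) (f≈±g z) ∘ proj₁ (f-pres x y z) ,
  proj₂ (f-pres x y z) ∘ T±-resp (≈±-sym (f≈±g x)) (≈±-sym (f≈±g y)) (≈±-sym (f≈±g z))

T±-Homo⇒PreservesT± : ∀ {f g} → (∀ x → g (f x) ≈± x) → T±-Homo f → T±-Homo g → PreservesT± f
T±-Homo⇒PreservesT± gf≈±id f-homo g-homo x y z =
  f-homo , T±-resp (gf≈±id x) (gf≈±id y) (gf≈±id z) ∘ g-homo

-- T-preserving permutations are linear up to sign

module PreservingT (σ : Perm) (preserves : PreservesT σ) where

  φ : M → M
  φ = to σ

  φ-cong : ∀ {x y} → x ≋ y → φ x ≋ φ y
  φ-cong = to-cong-≋ σ

  φ⁻¹ : M → M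
  φ⁻¹ = from σ

  φ⁻¹-cong : ∀ {x y} → x ≋ y → φ⁻¹ x ≋ φ⁻¹ y
  φ⁻¹-cong = from-cong-≋ σ

  φ-φ⁻¹ : ∀ y → φ (φ⁻¹ y) ≋ y
  φ-φ⁻¹ = to-from-≋ σ

  φ⁻¹-φ : ∀ x → φ⁻¹ (φ x) ≋ x
  φ⁻¹-φ = from-to-≋ σ

  φ-preserves-T± : T±-Homo φ
  φ-preserves-T± {x} {y} {z} = proj₁ (PreservesT⇒PreservesT± σ preserves x y z)

  φ-reflects-T± : ∀ {x y z} → T± (φ x) (φ y) (φ z) → T± x y z
  φ-reflects-T± {x} {y} {z} = proj₂ (PreservesT⇒PreservesT± σ preserves x y z)

  φ-[] : φ [] ≋ []
  φ-[] = T±-diagonal⇒[] (φ-preserves-T± {[]} {[]} {[]} (inj₁ ≈±-refl))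

  φ-preserves-≈± : ∀ {x z} → z ≈± x → φ z ≈± φ x
  φ-preserves-≈± h = T±-[]⇒≈± (T±-resp ≈±-refl (inj₁ φ-[]) ≈±-refl (φ-preserves-T± (≈±⇒T±-[] h)))

  φ-reflects-≈± : ∀ {x z} → φ z ≈± φ x → z ≈± x
  φ-reflects-≈± h = T±-[]⇒≈± (φ-reflects-T± (T±-resp ≈±-refl (inj₁ (≋-sym φ-[])) ≈±-refl (≈±⇒T±-[] h)))

  φ-≋[] : ∀ {x} → x ≋ [] → φ x ≋ []
  φ-≋[] h = ≋-trans (φ-cong h) φ-[]

  φ-≋[]⁻¹ : ∀ {x} → φ x ≋ [] → x ≋ []
  φ-≋[]⁻¹ h = ≈±-[] (φ-reflects-≈± (inj₁ (≋-trans h (≋-sym φ-[])))) ≋-refl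

  φ-⊖ : ∀ x → φ (⊖ x) ≈± φ x
  φ-⊖ x = φ-preserves-≈± (⊖x≈±x x)

  -- Were φ (v ⊕ w) ≈± B ⊕ ⊖ C instead, φ (u ⊕ v ⊕ w) would be T±-related to the pairs
  -- (A ⊕ B, C), (A ⊕ C, B) and (A, B ⊕ ⊖ C), which only a degenerate triple A, B, C allows.
  φ-⊕-coherent : ∀ u v w {A B C} → A ≈± φ u → B ≈± φ v → C ≈± φ w →
                 φ (u ⊕ v) ≈± A ⊕ B → φ (u ⊕ w) ≈± A ⊕ C →
                 Nonzero u → Nonzero v → Nonzero w →
                 Nonzero (u ⊕ v) → Nonzero (u ⊕ w) → Nonzero (v ⊕ w) →
                 φ (v ⊕ w) ≈± B ⊕ C
  φ-⊕-coherent u v w {A} {B} {C} hA hB hC huv huw u≢0 v≢0 w≢0 uv≢0 uw≢0 vw≢0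
    with T±-resp (≈±-sym hB) (≈±-sym hC) ≈±-refl (φ-preserves-T± {v} {w} {v ⊕ w} (inj₁ ≈±-refl))
  ... | inj₁ p = p
  ... | inj₂ p = ⊥-elim (nondegenerate (T±-three-ways⇒degenerate A B C d t₁ t₂ t₃))
    where
    uvw = u ∷ v ∷ w ∷ []
    d = φ ((u ⊕ v) ⊕ w)
    t₁ : T± (A ⊕ B) C d
    t₁ = T±-resp huv (≈±-sym hC) ≈±-refl (φ-preserves-T± {u ⊕ v} {w} (inj₁ ≈±-refl))
    t₂ : T± (A ⊕ C) B d
    t₂ = T±-resp huw (≈±-sym hB) ≈±-refl
           (φ-preserves-T± {u ⊕ w} {v} (inj₁ (inj₁ (solve ((#0 ⊞ #1) ⊞ #2) ((#0 ⊞ #2) ⊞ #1) uvw))))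
    t₃ : T± A (B ⊕ ⊖ C) d
    t₃ = T±-resp (≈±-sym hA) p ≈±-refl
           (φ-preserves-T± {u} {v ⊕ w} (inj₁ (inj₁ (solve ((#0 ⊞ #1) ⊞ #2) (#0 ⊞ (#1 ⊞ #2)) uvw))))
    nondegenerate : ¬ Degenerate A B C
    nondegenerate (inj₁ z)                                   = u≢0  (φ-≋[]⁻¹ (≈±-[] (≈±-sym hA) z))
    nondegenerate (inj₂ (inj₁ z))                            = v≢0  (φ-≋[]⁻¹ (≈±-[] (≈±-sym hB) z))
    nondegenerate (inj₂ (inj₂ (inj₁ z)))                     = w≢0  (φ-≋[]⁻¹ (≈±-[] (≈±-sym hC) z))
    nondegenerate (inj₂ (inj₂ (inj₂ (inj₁ z))))              = uv≢0 (φ-≋[]⁻¹ (≈±-[] huv z))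
    nondegenerate (inj₂ (inj₂ (inj₂ (inj₂ (inj₁ z)))))       = uw≢0 (φ-≋[]⁻¹ (≈±-[] huw z))
    nondegenerate (inj₂ (inj₂ (inj₂ (inj₂ (inj₂ z)))))       = vw≢0 (φ-≋[]⁻¹ (≈±-[] p z))

  φ-⊖⊕ : ∀ u v {A B} → A ≈± φ u → B ≈± φ v → φ (u ⊕ v) ≈± A ⊕ B → Nonzero u → Nonzero v →
         φ (⊖ u ⊕ v) ≈± ⊖ A ⊕ B
  φ-⊖⊕ u v {A} {B} hA hB huv u≢0 v≢0
    with T±-resp (≈±-sym hA) (≈±-sym hB) ≈±-refl (φ-preserves-T± {u} {v} {u ⊕ ⊖ v} (inj₂ ≈±-refl))
  -- φ (u ⊕ ⊖ v) ≈± φ (u ⊕ v) would force v or u to vanish.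
  ... | inj₁ p = ⊥-elim (Sum.[ v≢0 , u≢0 ]
        (cancel-≈± -½ ½ (solve #1 (-½ ⊡ ((#0 ⊞ ⊟ #1) ⊞ ⊟ (#0 ⊞ #1))) (u ∷ v ∷ []))
                        (solve #0 (½ ⊡ ((#0 ⊞ ⊟ #1) ⊞ (#0 ⊞ #1))) (u ∷ v ∷ []))
                        ≈±-refl (φ-reflects-≈± (≈±-trans p (≈±-sym huv)))))
  ... | inj₂ p = ≈±-trans (φ-preserves-≈± (inj₂ (solve (⊟ #0 ⊞ #1) (⊟ (#0 ⊞ ⊟ #1)) (u ∷ v ∷ []))))
                   (≈±-trans p (inj₂ (solve (#0 ⊞ ⊟ #1) (⊟ (⊟ #0 ⊞ #1)) (A ∷ B ∷ []))))

  φ-fromℕ· : ∀ k x → φ (fromℕ k · x) ≈± fromℕ k · φ x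
  φ-fromℕ· 0             x = inj₁ (≋-trans (φ-≋[] (·-zeroˡ x)) (≋-sym (·-zeroˡ (φ x))))
  φ-fromℕ· 1             x = inj₁ (≋-trans (φ-cong (fromℕ-1-· x)) (≋-sym (fromℕ-1-· (φ x))))
  φ-fromℕ· (suc (suc k)) x = split (T±-resp (φ-fromℕ· (suc k) x) ≈±-refl ≈±-refl
    (φ-preserves-T± {fromℕ (suc k) · x} {x} {fromℕ (2 ℕ.+ k) · x} (inj₁ (inj₁ (fromℕ-suc-· (suc k) x)))))
    where
    split : T± (fromℕ (suc k) · φ x) (φ x) (φ (fromℕ (2 ℕ.+ k) · x)) →
            φ (fromℕ (2 ℕ.+ k) · x) ≈± fromℕ (2 ℕ.+ k) · φ x
    split (inj₁ p) = ≈±-≋-trans p (≋-sym (fromℕ-suc-· (suc k) (φ x)))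
    split (inj₂ p) = inj₁ (≋-trans (φ-≋[] (·-congʳ (fromℕ (2 ℕ.+ k)) x≋0))
                                   (≋-sym (·-congʳ (fromℕ (2 ℕ.+ k)) (φ-≋[] x≋0))))
      where
      -- φ ((2 + k) x) ≈± (1 + k) φ x ⊕ ⊖ φ x ≋ k φ x ≈± φ (k x), and φ reflects ≈±.
      x≋0 : x ≋ []
      x≋0 = [2+k]·x≈±k·x⇒x≋[] k x
        (φ-reflects-≈± (≈±-trans p (≋-≈±-trans (fromℕ-suc-·-⊖ k (φ x)) (≈±-sym (φ-fromℕ· k x)))))

  φ-fromℤ· : ∀ z x → φ (fromℤ z · x) ≈± fromℤ z · φ x
  φ-fromℤ· (+ m)    x = φ-fromℕ· m x
  φ-fromℤ· -[1+ m ] x = begin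
    φ ((- fromℕ (suc m)) · x)  ≈⟨ φ-preserves-≈± (inj₁ (-‿· (fromℕ (suc m)) x)) ⟩
    φ (⊖ (fromℕ (suc m) · x))  ≈⟨ φ-⊖ (fromℕ (suc m) · x) ⟩
    φ (fromℕ (suc m) · x)      ≈⟨ φ-fromℕ· (suc m) x ⟩
    fromℕ (suc m) · φ x        ≈⟨ ≈±-sym (inj₂ (-‿· (fromℕ (suc m)) (φ x))) ⟩
    (- fromℕ (suc m)) · φ x    ∎
    where open ≈±-Reasoning

  φ-· : ∀ q x → φ (q · x) ≈± q · φ x
  φ-· q x = begin
    φ (q · x)        ≈⟨ inj₁ (φ-cong (≋-trans (·-congˡ x q≡N*r) (≋-sym (·-assoc N r x)))) ⟩
    φ (N · y)        ≈⟨ φ-fromℤ· (ℚ.↥ q) y ⟩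
    N · φ y          ≈⟨ ·-cong-≈± N φy≈±r·φx ⟩
    N · (r · φ x)    ≈⟨ inj₁ (≋-trans (·-assoc N r (φ x)) (·-congˡ (φ x) (sym q≡N*r))) ⟩
    q · φ x          ∎
    where
    open ≈±-Reasoning
    D N r : ℚ
    D = fromℕ (ℚ.↧ₙ q)
    N = fromℤ (ℚ.↥ q)
    instance _ = fromℕ-suc-nonZero (ℚ.denominator-1 q)
    r = 1/ D
    y = r · x
    q≡N*r : q ≡ N * r
    q≡N*r = ≡-↥*1/↧ q
    φy≈±r·φx : φ y ≈± r · φ x
    φy≈±r·φx = ≈±-sym (begin
      r · φ x          ≈⟨ ·-cong-≈± r (inj₁ (φ-cong (≋-sym (·-·-inverseʳ D x)))) ⟩
      r · φ (D · y)    ≈⟨ ·-cong-≈± r (φ-fromℕ· (ℚ.↧ₙ q) y) ⟩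
      r · (D · φ y)    ≈⟨ inj₁ (·-·-inverseˡ D (φ y)) ⟩
      φ y              ∎)

module Linearisation (σ : Perm) (preserves : PreservesT σ) where
  open PreservingT σ preserves

  e₀ : M
  e₀ = basis 0

  e₀≢0 : Nonzero e₀
  e₀≢0 = ⊕-basis-nonzero 0 [] z≤n

  -- φ (basis n), with its sign fixed so that φ (e₀ ⊕ basis n) ≈± E 0 ⊕ E n.
  E : ℕ → M
  E zero    = φ e₀
  E (suc n) = signed (φ (e₀ ⊕ basis (suc n)) ≈±? φ e₀ ⊕ φ (basis (suc n))) (φ (basis (suc n)))

  E-≈± : ∀ n → E n ≈± φ (basis n)
  E-≈± zero    = ≈±-refl
  E-≈± (suc n) = signed-≈± (φ (e₀ ⊕ basis (suc n)) ≈±? φ e₀ ⊕ φ (basis (suc n))) (φ (basis (suc n)))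

  φ-e₀⊕basis : ∀ n → φ (e₀ ⊕ basis (suc n)) ≈± E 0 ⊕ E (suc n)
  φ-e₀⊕basis n with φ (e₀ ⊕ basis (suc n)) ≈±? φ e₀ ⊕ φ (basis (suc n))
  ... | yes h  = h
  ... | no  ¬h = Sum.[ ⊥-elim ∘ ¬h , id ]′ (φ-preserves-T± {e₀} {basis (suc n)} (inj₁ ≈±-refl))

  open LinearExtension E

  φ-⊕-basis : ∀ n → (∀ x → length x ℕ.≤ n → φ x ≈± Λ x) →
              ∀ b → length b ℕ.≤ n → φ (b ⊕ basis n) ≈± Λ b ⊕ E n
  φ-⊕-basis n φ≈±Λ b hb with b ≋? []
  ... | yes b≋0 = begin
    φ (b ⊕ basis n)  ≈⟨ inj₁ (φ-cong (⊕-cong b≋0 ≋-refl)) ⟩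
    φ (basis n)      ≈⟨ ≈±-sym (E-≈± n) ⟩
    E n              ≈⟨ inj₁ (⊕-cong (≋-sym (extend-cong 0 b≋0)) ≋-refl) ⟩
    Λ b ⊕ E n        ∎
    where open ≈±-Reasoning
  φ-⊕-basis zero    φ≈±Λ b hb | no b≢0 = ⊥-elim (b≢0 (length≤0⇒≋[] b hb))
  φ-⊕-basis (suc m) φ≈±Λ b hb | no b≢0 with e₀ ⊕ b ≋? []
  ... | yes e₀⊕b≋0 = begin
    φ (b ⊕ basis (suc m))       ≈⟨ inj₁ (φ-cong (⊕-cong b≋⊖e₀ ≋-refl)) ⟩
    φ (⊖ e₀ ⊕ basis (suc m))    ≈⟨ φ-⊖⊕ e₀ (basis (suc m)) ≈±-refl (E-≈± (suc m)) (φ-e₀⊕basis m)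
                                      e₀≢0 (⊕-basis-nonzero (suc m) [] z≤n) ⟩
    ⊖ E 0 ⊕ E (suc m)           ≈⟨ inj₁ (⊕-cong (≋-sym Λb≋⊖E₀) ≋-refl) ⟩
    Λ b ⊕ E (suc m)             ∎
    where
    open ≈±-Reasoning
    b≋⊖e₀ : b ≋ ⊖ e₀
    b≋⊖e₀ = ≋-trans (solve #1 ((#0 ⊞ #1) ⊞ ⊟ #0) (e₀ ∷ b ∷ [])) (⊕-cong e₀⊕b≋0 ≋-refl)
    Λb≋⊖E₀ : Λ b ≋ ⊖ E 0
    Λb≋⊖E₀ = ≋-trans (extend-cong 0 b≋⊖e₀) (≋-trans (extend-⊖ 0 e₀) (⊖-cong (extend-basis 0 0)))
  ... | no e₀⊕b≢0 = φ-⊕-coherent e₀ b (basis (suc m)) ≈±-refl (≈±-sym (φ≈±Λ b hb)) (E-≈± (suc m))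
                      φ-e₀⊕b (φ-e₀⊕basis m)
                      e₀≢0 b≢0 (⊕-basis-nonzero (suc m) [] z≤n)
                      e₀⊕b≢0 (⊕-basis-nonzero (suc m) e₀ (s≤s z≤n)) (⊕-basis-nonzero (suc m) b hb)
    where
    φ-e₀⊕b : φ (e₀ ⊕ b) ≈± E 0 ⊕ Λ b
    φ-e₀⊕b = ≈±-≋-trans (φ≈±Λ (e₀ ⊕ b) (length-⊕-≤ (suc m) e₀ b (s≤s z≤n) hb))
                        (≋-trans (extend-⊕ 0 e₀ b) (⊕-cong (extend-basis 0 0) ≋-refl))

  φ≈±Λ-≤ : ∀ n x → length x ℕ.≤ n → φ x ≈± Λ x
  φ≈±Λ-≤ zero    x h = inj₁ (≋-trans (φ-≋[] x≋0) (≋-sym (extend-cong 0 x≋0)))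
    where x≋0 = length≤0⇒≋[] x h
  φ≈±Λ-≤ (suc n) x h = begin
    φ x                  ≈⟨ inj₁ (φ-cong (≋-take-⊕-last n x h)) ⟩
    φ (a ⊕ q · basis n)  ≈⟨ φ-a⊕q·eₙ (q ℚ.≟ 0ℚ) ⟩
    Λ a ⊕ q · E n        ≈⟨ inj₁ (≋-sym Λx≋) ⟩
    Λ x                  ∎
    where
    open ≈±-Reasoning
    a = take n x
    q = coord x n
    a-short : length a ℕ.≤ n
    a-short = length-take-≤ n x
    Λx≋ : Λ x ≋ Λ a ⊕ q · E n
    Λx≋ = ≋-trans (extend-cong 0 (≋-take-⊕-last n x h)) (≋-trans (extend-⊕ 0 a (q · basis n))
            (⊕-cong ≋-refl (≋-trans (extend-· 0 q (basis n)) (·-congʳ q (extend-basis 0 n)))))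
    φ-a⊕q·eₙ : Dec (q ≡ 0ℚ) → φ (a ⊕ q · basis n) ≈± Λ a ⊕ q · E n
    φ-a⊕q·eₙ (yes q≡0) = begin
      φ (a ⊕ q · basis n)  ≈⟨ inj₁ (φ-cong (⊕-cong ≋-refl (q·≋[] (basis n)))) ⟩
      φ (a ⊕ [])           ≈⟨ inj₁ (φ-cong (solve (#0 ⊞ 𝟘) #0 (a ∷ []))) ⟩
      φ a                  ≈⟨ φ≈±Λ-≤ n a a-short ⟩
      Λ a                  ≈⟨ inj₁ (solve #0 (#0 ⊞ 𝟘) (Λ a ∷ [])) ⟩
      Λ a ⊕ []             ≈⟨ inj₁ (⊕-cong ≋-refl (≋-sym (q·≋[] (E n)))) ⟩
      Λ a ⊕ q · E n        ∎
      where
      q·≋[] : ∀ y → q · y ≋ []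
      q·≋[] y = ≋-trans (·-congˡ y q≡0) (·-zeroˡ y)
    -- Scaling by q reduces to the vector a / q ⊕ basis n, covered by φ-⊕-basis.
    φ-a⊕q·eₙ (no q≢0) = begin
      φ (a ⊕ q · basis n)      ≈⟨ inj₁ (φ-cong (≋-sym (≋-trans (·-distribˡ-⊕ q a′ (basis n)) (⊕-cong qa′≋a ≋-refl)))) ⟩
      φ (q · (a′ ⊕ basis n))   ≈⟨ φ-· q (a′ ⊕ basis n) ⟩
      q · φ (a′ ⊕ basis n)     ≈⟨ ·-cong-≈± q (φ-⊕-basis n (φ≈±Λ-≤ n) a′ a′-short) ⟩
      q · (Λ a′ ⊕ E n)         ≈⟨ inj₁ (≋-trans (·-distribˡ-⊕ q (Λ a′) (E n))
                                    (⊕-cong (≋-trans (≋-sym (extend-· 0 q a′)) (extend-cong 0 qa′≋a)) ≋-refl)) ⟩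
      Λ a ⊕ q · E n            ∎
      where
      instance _ = ℚ.≢-nonZero q≢0
      a′ = (1/ q) · a
      a′-short : length a′ ℕ.≤ n
      a′-short = ℕₚ.≤-trans (ℕₚ.≤-reflexive (length-· (1/ q) a)) a-short
      qa′≋a : q · a′ ≋ a
      qa′≋a = ·-·-inverseʳ q a

  φ≈±Λ : ∀ x → φ x ≈± Λ x
  φ≈±Λ x = φ≈±Λ-≤ (length x) x ℕₚ.≤-refl

  Λ-injective : ∀ {x y} → Λ x ≋ Λ y → x ≋ y
  Λ-injective {x} {y} Λx≋Λy = ≋-trans (solve #0 ((#0 ⊞ ⊟ #1) ⊞ #1) (x ∷ y ∷ [])) (⊕-cong x-y≋0 ≋-refl)
    where
    Λ[x-y]≋0 : Λ (x ⊕ ⊖ y) ≋ []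
    Λ[x-y]≋0 = ≋-trans (extend-⊕ 0 x (⊖ y)) (≋-trans (⊕-cong Λx≋Λy (extend-⊖ 0 y)) (≋⇒difference-[] (≋-refl {Λ y})))
    x-y≋0 : x ⊕ ⊖ y ≋ []
    x-y≋0 = φ-≋[]⁻¹ (≈±-[] (φ≈±Λ (x ⊕ ⊖ y)) Λ[x-y]≋0)

  -- φ⁻¹ y solves Λ x ≋ y up to sign, so one of ± φ⁻¹ y solves it exactly.
  Λ⁻¹ : M → M
  Λ⁻¹ y = signed (Λ (φ⁻¹ y) ≋? y) (φ⁻¹ y)

  Λ⁻¹≈±φ⁻¹ : ∀ y → Λ⁻¹ y ≈± φ⁻¹ y
  Λ⁻¹≈±φ⁻¹ y = signed-≈± (Λ (φ⁻¹ y) ≋? y) (φ⁻¹ y)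

  Λ-φ⁻¹ : ∀ y → Λ (φ⁻¹ y) ≈± y
  Λ-φ⁻¹ y = ≈±-trans (≈±-sym (φ≈±Λ (φ⁻¹ y))) (inj₁ (φ-φ⁻¹ y))

  Λ-Λ⁻¹ : ∀ y → Λ (Λ⁻¹ y) ≋ y
  Λ-Λ⁻¹ y with Λ (φ⁻¹ y) ≋? y
  ... | yes Λφ⁻¹y≋y = Λφ⁻¹y≋y
  ... | no  Λφ⁻¹y≉y = ≋-trans (extend-⊖ 0 (φ⁻¹ y)) (≋-trans (⊖-cong Λφ⁻¹y≋⊖y) (⊖-involutive y))
    where
    Λφ⁻¹y≋⊖y : Λ (φ⁻¹ y) ≋ ⊖ y
    Λφ⁻¹y≋⊖y = Sum.[ ⊥-elim ∘ Λφ⁻¹y≉y , id ]′ (Λ-φ⁻¹ y)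

  Λ⁻¹-Λ : ∀ x → Λ⁻¹ (Λ x) ≋ x
  Λ⁻¹-Λ x = Λ-injective (Λ-Λ⁻¹ (Λ x))

  Λ⁻¹-cong : ∀ {y y′} → y ≋ y′ → Λ⁻¹ y ≋ Λ⁻¹ y′
  Λ⁻¹-cong {y} {y′} h = Λ-injective (≋-trans (Λ-Λ⁻¹ y) (≋-trans h (≋-sym (Λ-Λ⁻¹ y′))))

  Λᴾ : Perm
  Λᴾ = record
    { to        = Λ
    ; from      = Λ⁻¹
    ; to-cong   = λ {x} {y} h → ≋⇒≈ (extend-cong 0 {x} {y} ⟨ h ⟩)
    ; from-cong = λ {x} {y} h → ≋⇒≈ (Λ⁻¹-cong {x} {y} ⟨ h ⟩)
    ; to-from   = ≋⇒≈ ∘ Λ-Λ⁻¹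
    ; from-to   = ≋⇒≈ ∘ Λ⁻¹-Λ
    }

  Λᴾ-GL : IsGL Λᴾ
  Λᴾ-GL = (λ x y → ≋⇒≈ (extend-⊕ 0 x y)) , (λ c x → ≋⇒≈ (extend-· 0 c x))

  signᴾ : Perm
  signᴾ = record
    { to        = Λ⁻¹ ∘ φ
    ; from      = φ⁻¹ ∘ Λ
    ; to-cong   = λ {x} {y} h → ≋⇒≈ (Λ⁻¹-cong (φ-cong {x} {y} ⟨ h ⟩))
    ; from-cong = λ {x} {y} h → ≋⇒≈ (φ⁻¹-cong (extend-cong 0 {x} {y} ⟨ h ⟩))
    ; to-from   = λ y → ≋⇒≈ (≋-trans (Λ⁻¹-cong (φ-φ⁻¹ (Λ y))) (Λ⁻¹-Λ y))
    ; from-to   = λ x → ≋⇒≈ (≋-trans (φ⁻¹-cong (Λ-Λ⁻¹ (φ x))) (φ⁻¹-φ x))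
    }

  signᴾ-S± : IsS± signᴾ
  signᴾ-S± x = Sum.map ≋⇒≈ ≋⇒≈ (≈±-trans (Λ⁻¹≈±φ⁻¹ (φ x)) (inj₁ (φ⁻¹-φ x)))

  σ∈GL± : InGL± σ
  σ∈GL± = ((Λᴾ , inj₁ Λᴾ-GL) , true) ∷ ((signᴾ , inj₂ signᴾ-S±) , true) ∷ [] ,
          λ x → ≋⇒≈ (≋-sym (Λ-Λ⁻¹ (φ x)))

-- Linear maps and sign changes preserve T

record IsLinear (f : M → M) : Set where
  field
    cong-≋ : ∀ {x y} → x ≋ y → f x ≋ f y
    ⊕-homo : ∀ x y → f (x ⊕ y) ≋ f x ⊕ f y
    ·-homo : ∀ c x → f (c · x) ≋ c · f x

  ⊖-homo : ∀ x → f (⊖ x) ≋ ⊖ f x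
  ⊖-homo x = ≋-trans (cong-≋ (≋-sym (-1·≋⊖ x))) (≋-trans (·-homo (- 1ℚ) x) (-1·≋⊖ (f x)))
    where
    -1·≋⊖ : ∀ y → (- 1ℚ) · y ≋ ⊖ y
    -1·≋⊖ y = ≋-trans (-‿· 1ℚ y) (⊖-cong (·-identityˡ y))

  cong-≈± : ∀ {x y} → x ≈± y → f x ≈± f y
  cong-≈±         (inj₁ h) = inj₁ (cong-≋ h)
  cong-≈± {y = y} (inj₂ h) = inj₂ (≋-trans (cong-≋ h) (⊖-homo y))

  T±-homo : T±-Homo f
  T±-homo {x} {y} (inj₁ h) = inj₁ (≈±-≋-trans (cong-≈± h) (⊕-homo x y))
  T±-homo {x} {y} (inj₂ h) = inj₂ (≈±-≋-trans (cong-≈± h) (≋-trans (⊕-homo x (⊖ y)) (⊕-cong ≋-refl (⊖-homo y))))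

module _ (π : Perm) where

  linear-inverse : IsLinear (to π) → IsLinear (from π)
  linear-inverse lin = record
    { cong-≋ = from-cong-≋ π
    ; ⊕-homo = λ x y → ≋-trans (from-cong-≋ π (⊕-cong (≋-sym (to-from-≋ π x)) (≋-sym (to-from-≋ π y))))
                        (≋-trans (from-cong-≋ π (≋-sym (⊕-homo (from π x) (from π y)))) (from-to-≋ π _))
    ; ·-homo = λ c x → ≋-trans (from-cong-≋ π (·-congʳ c (≋-sym (to-from-≋ π x))))
                        (≋-trans (from-cong-≋ π (≋-sym (·-homo c (from π x)))) (from-to-≋ π _))
    }
    where open IsLinear lin

  generator⇒PreservesT± : IsGL π ⊎ IsS± π → PreservesT± (to π) × PreservesT± (from π)
  generator⇒PreservesT± (inj₁ (⊕-homo , ·-homo)) =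
    T±-Homo⇒PreservesT± (inj₁ ∘ from-to-≋ π) (T±-homo to-linear) (T±-homo (linear-inverse to-linear)) ,
    T±-Homo⇒PreservesT± (inj₁ ∘ to-from-≋ π) (T±-homo (linear-inverse to-linear)) (T±-homo to-linear)
    where
    open IsLinear using (T±-homo)
    to-linear : IsLinear (to π)
    to-linear = record { cong-≋ = to-cong-≋ π ; ⊕-homo = λ x y → ⟨ ⊕-homo x y ⟩ ; ·-homo = λ c x → ⟨ ·-homo c x ⟩ }
  generator⇒PreservesT± (inj₂ signs) = PreservesT±-resp (≈±-sym ∘ to≈±id) PreservesT±-id ,
                                        PreservesT±-resp (≈±-sym ∘ from≈±id) PreservesT±-id
    where
    to≈±id : ∀ x → to π x ≈± x
    to≈±id x = Sum.map ⟨_⟩ ⟨_⟩ (signs x)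
    from≈±id : ∀ x → from π x ≈± x
    from≈±id x = ≈±-trans (≈±-sym (to≈±id (from π x))) (inj₁ (to-from-≋ π x))

evalWord-PreservesT± : ∀ w → PreservesT± (evalWord w)
evalWord-PreservesT± []                        = PreservesT±-id
evalWord-PreservesT± (((g , gen) , true)  ∷ w) = PreservesT±-∘ (proj₁ (generator⇒PreservesT± g gen)) (evalWord-PreservesT± w)
evalWord-PreservesT± (((g , gen) , false) ∷ w) = PreservesT±-∘ (proj₂ (generator⇒PreservesT± g gen)) (evalWord-PreservesT± w)

InGL±⇒PreservesT : ∀ σ → InGL± σ → PreservesT σ
InGL±⇒PreservesT σ (w , σ≈w) =
  PreservesT±⇒PreservesT σ (PreservesT±-resp (λ v → inj₁ (≋-sym ⟨ σ≈w v ⟩)) (evalWord-PreservesT± w))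

mainTheorem7 : (σ : Perm) → (PreservesT σ → InGL± σ) × (InGL± σ → PreservesT σ)
mainTheorem7 σ = Linearisation.σ∈GL± σ , InGL±⇒PreservesT σ
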